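{- Let $\mathcal{G}=(V,E)$ be a graph and $I\subseteq V$ an independent set such that $\mathcal{G}\setminus I$ is bipartite. If there exist $k$ pairwise edge-separate vertex covers of $\mathcal{G}\setminus I$ (with respect to $\mathcal{G}$), then for every $w\in Q^W$, \[R(w):=\frac{w(I)+w(OPT(\mathcal{G}\setminus I))}{w(OPT(\mathcal{G}))}\le 1+\frac1k.\]
   Context: $\mathcal{G}\setminus I=(V\setminus I,E')$ is obtained by deleting $I$ and all incident edges. For a vertex cover $U\subseteq V\setminus I$ of $\mathcal{G}\setminus I$, let $E_U=\{(u,v)\in E': u\in U, v\in U\}\cup\{(u,v)\in E: u\in U, v\in I\}$. Two vertex covers $U_1,U_2\subseteq V\setminus I$ of $\mathcal{G}\setminus I$ are edge-separate with respect to $\mathcal{G}$ if $E_{U_1}\cap E_{U_2}=\emptyset$. $Q^W$ is the set of $w\in\mathbb{R}_+^V$ with $w(V)=2$ for which some $y\in\mathbb{R}_+^E$ satisfies $y(\delta(v))=w_v$ for all $v$ ($\delta(v)$ = edges incident to $v$). A vertex cover contains at least one endpoint of every edge; $OPT(\mathcal{H})$ is a minimum $w$-weight vertex cover of $\mathcal{H}$; $w(X)=\sum_{v\in X}w_v$.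
   Formalization: The weight vectors w in $Q^W$ and their witnesses y have rational entries instead of lying in $\mathbb{R}_+^V$ and $\mathbb{R}_+^E$. -}

module Defs where

open import Data.Nat using (ℕ; zero; suc)
open import Data.Fin using (Fin; zero; suc)
open import Data.Bool using (Bool; true; false; if_then_else_; T; _∧_; _∨_; not)
open import Data.Product using (_×_; _,_; proj₁; proj₂)
open import Data.Sum using (_⊎_)
open import Data.Rational using (ℚ; 0ℚ; _+_; _≤_)
open import Relation.Binary.PropositionalEquality using (_≡_; _≢_)
open import Relation.Nullary using (¬_)

record Graph : Set where
  field
    n        : ℕ
    m        : ℕ
    src      : Fin m → Fin n
    tgt      : Fin m → Fin n
    loopless : ∀ e → src e ≢ tgt e
    -- no two indices denote the same (unordered) edge
    simple   : ∀ e f → (src e ≡ src f × tgt e ≡ tgt f) ⊎ (src e ≡ tgt f × tgt e ≡ src f)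
                     → e ≡ f

open Graph public

VSet : ℕ → Set
VSet n = Fin n → Bool

sumFin : (n : ℕ) → (Fin n → ℚ) → ℚ
sumFin zero    f = 0ℚ
sumFin (suc n) f = f zero + sumFin n (λ i → f (suc i))

wt : ∀ {n} → (Fin n → ℚ) → VSet n → ℚ
wt {n} w X = sumFin n (λ v → if X v then w v else 0ℚ)

module _ (G : Graph) where

  Independent : VSet (n G) → Set
  Independent I = ∀ e → ¬ (T (I (src G e)) × T (I (tgt G e)))

  InMinus : VSet (n G) → Fin (m G) → Set
  InMinus I e = T (not (I (src G e))) × T (not (I (tgt G e)))

  BipartiteMinus : VSet (n G) → Set
  BipartiteMinus I = Σ' (VSet (n G)) λ c → ∀ e → InMinus I e → c (src G e) ≢ c (tgt G e)
    where
    open import Data.Product using () renaming (Σ to Σ')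

  VertexCover : VSet (n G) → Set
  VertexCover U = ∀ e → T (U (src G e) ∨ U (tgt G e))

  VertexCoverMinus : VSet (n G) → VSet (n G) → Set
  VertexCoverMinus I U =
    (∀ v → T (U v) → T (not (I v))) ×
    (∀ e → InMinus I e → T (U (src G e) ∨ U (tgt G e)))

  InEU : VSet (n G) → VSet (n G) → Fin (m G) → Set
  InEU I U e =
    (InMinus I e × T (U (src G e)) × T (U (tgt G e))) ⊎
    ((T (U (src G e)) × T (I (tgt G e))) ⊎ (T (I (src G e)) × T (U (tgt G e))))

  EdgeSeparate : VSet (n G) → VSet (n G) → VSet (n G) → Set
  EdgeSeparate I U₁ U₂ = ∀ e → ¬ (InEU I U₁ e × InEU I U₂ e)

  InQW : (Fin (n G) → ℚ) → Set
  InQW w =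
    (∀ v → 0ℚ ≤ w v) ×
    (sumFin (n G) w ≡ Data.Rational.1ℚ + Data.Rational.1ℚ) ×
    Σ' (Fin (m G) → ℚ) λ y →
      (∀ e → 0ℚ ≤ y e) ×
      (∀ v → sumFin (m G) (λ e → if isYes (src G e ≟ v) ∨ isYes (tgt G e ≟ v) then y e else 0ℚ) ≡ w v)
    where
    open import Data.Product using () renaming (Σ to Σ')
    import Data.Rational
    open import Data.Fin using (_≟_)
    open import Relation.Nullary.Decidable using (isYes)

  IsOPT : (Fin (n G) → ℚ) → VSet (n G) → Set
  IsOPT w C = VertexCover C × (∀ D → VertexCover D → wt w C ≤ wt w D)

  IsOPTMinus : VSet (n G) → (Fin (n G) → ℚ) → VSet (n G) → Set
  IsOPTMinus I w C = VertexCoverMinus I C × (∀ D → VertexCoverMinus I D → wt w C ≤ wt w D)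

{-# OPTIONS --safe #-}
-- Let y ≥ 0 be the edge weights with y(δ(v)) = w_v. Counting with
-- multiplicity, w(X) = Σₑ y_e |X ∩ e| for every X ⊆ V. For an edge e and a
-- cover Uᵢ of G ∖ I one checks |I ∩ e| + |Uᵢ ∩ e| = 1 + [e ∈ E_{Uᵢ}], and by
-- edge-separateness e lies in at most one E_{Uᵢ}. Summing over i and e gives
-- Σᵢ (w(I) + w(Uᵢ)) ≤ (k + 1) y(E) ≤ (k + 1) w(OPT(G)), the last step because
-- a vertex cover meets every edge; and w(OPT(G ∖ I)) ≤ w(Uᵢ) for each i.
module Submission where

open import Defs

open import Algebra.Bundles using (Ring)
open import Data.Bool using (Bool; true; false; if_then_else_; T; T?; _∧_; _∨_; not)
open import Data.Bool.Properties using (T-∧; T-∨)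
open import Data.Empty using (⊥-elim)
open import Data.Fin using (Fin; zero; suc; _≟_)
open import Data.Fin.Properties using (0≢1+n; suc-injective)
open import Data.Integer using (+_)
import Data.Integer as ℤ
import Data.Integer.Properties as ℤ
open import Data.Nat using (ℕ; zero; suc; NonZero)
import Data.Nat.Coprimality as Coprime
open import Data.Product using (_×_; _,_; proj₁)
open import Data.Rational using (ℚ; 0ℚ; 1ℚ; mkℚ; _/_; _+_; _*_; _≤_)
open import Data.Rational.Properties
  using ( normalize-coprime; normalize-nonNeg; +-*-ring; +-identityˡ; +-identityʳ; +-comm
        ; *-identityˡ; *-zeroˡ; *-distribʳ-+; ≤-refl; ≤-reflexive; +-mono-≤; +-monoʳ-≤
        ; *-monoˡ-≤-nonNeg; module ≤-Reasoning)
import Data.Sum as Sum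
open import Data.Unit using (tt)
open import Function using (Equivalence)
open import Relation.Binary.PropositionalEquality
  using (_≡_; _≢_; refl; sym; trans; cong; cong₂; module ≡-Reasoning)
open import Relation.Nullary using (¬_; yes; no)
open import Relation.Nullary.Decidable using (isYes; ⌊⌋-map′; toWitness; decidable-stable)

open import Algebra.Properties.Semiring.Sum (Ring.semiring +-*-ring)
  using (sum-syntax; sum-cong-≗; sum-replicate-zero; ∑-distrib-+; ∑-comm; *-distribˡ-sum)

open Equivalence using (to)

+k/1≡mkℚ : ∀ k → + k / 1 ≡ mkℚ (+ k) 0 (Coprime.sym (Coprime.1-coprimeTo k))
+k/1≡mkℚ k = normalize-coprime (Coprime.sym (Coprime.1-coprimeTo k))

+[1+k]/1≡1++k/1 : ∀ k → + suc k / 1 ≡ 1ℚ + + k / 1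
+[1+k]/1≡1++k/1 k = begin
  + suc k / 1                                                ≡⟨ cong (λ i → (+ 1 ℤ.+ i) / 1) (sym (ℤ.*-identityʳ (+ k))) ⟩
  1ℚ + mkℚ (+ k) 0 (Coprime.sym (Coprime.1-coprimeTo k))   ≡⟨ cong (_+_ 1ℚ) (sym (+k/1≡mkℚ k)) ⟩
  1ℚ + + k / 1                                               ∎
  where open ≡-Reasoning

infixr 11 [_]·_

[_]·_ : Bool → ℚ → ℚ
[ b ]· q = if b then q else 0ℚ

[]·-true : ∀ {b} q → T b → [ b ]· q ≡ q
[]·-true {true} q _ = refl

[]·-false : ∀ {b} q → ¬ T b → [ b ]· q ≡ 0ℚ
[]·-false {true}  q ¬b = ⊥-elim (¬b tt)
[]·-false {false} q _  = refl

[]·-comm : ∀ a b q → [ a ]· [ b ]· q ≡ [ b ]· [ a ]· q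
[]·-comm true  b     q = refl
[]·-comm false true  q = refl
[]·-comm false false q = refl

[]·-∨ : ∀ {a b} q → ¬ (T a × T b) → [ a ∨ b ]· q ≡ [ a ]· q + [ b ]· q
[]·-∨ {true}  {true}  q ¬ab = ⊥-elim (¬ab (tt , tt))
[]·-∨ {true}  {false} q _   = sym (+-identityʳ q)
[]·-∨ {false} {true}  q _   = sym (+-identityˡ q)
[]·-∨ {false} {false} q _   = sym (+-identityˡ 0ℚ)

[]·-∑ : ∀ b {n} (f : Fin n → ℚ) → [ b ]· (∑[ i < n ] f i) ≡ ∑[ i < n ] [ b ]· f i
[]·-∑ true  f     = refl
[]·-∑ false {n} f = sym (sum-replicate-zero n)

sumFin≡∑ : ∀ n (f : Fin n → ℚ) → sumFin n f ≡ ∑[ i < n ] f i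
sumFin≡∑ zero    f = refl
sumFin≡∑ (suc n) f = cong (_+_ (f zero)) (sumFin≡∑ n (λ i → f (suc i)))

∑-mono-≤ : ∀ {n} {f g : Fin n → ℚ} → (∀ i → f i ≤ g i) → ∑[ i < n ] f i ≤ ∑[ i < n ] g i
∑-mono-≤ {zero}  _   = ≤-refl
∑-mono-≤ {suc n} f≤g = +-mono-≤ (f≤g zero) (∑-mono-≤ (λ i → f≤g (suc i)))

∑-const : ∀ k c → ∑[ i < k ] c ≡ + k / 1 * c
∑-const zero    c = sym (*-zeroˡ c)
∑-const (suc k) c = begin
  c + ∑[ i < k ] c        ≡⟨ cong₂ _+_ (sym (*-identityˡ c)) (∑-const k c) ⟩
  1ℚ * c + + k / 1 * c    ≡⟨ sym (*-distribʳ-+ c 1ℚ (+ k / 1)) ⟩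
  (1ℚ + + k / 1) * c      ≡⟨ cong (_* c) (sym (+[1+k]/1≡1++k/1 k)) ⟩
  + suc k / 1 * c         ∎
  where open ≡-Reasoning

∑-delta : ∀ {n} (a : Fin n) (f : Fin n → ℚ) → ∑[ v < n ] [ isYes (a ≟ v) ]· f v ≡ f a
∑-delta {suc n} zero    f = trans (cong (_+_ (f zero)) (sum-replicate-zero n)) (+-identityʳ (f zero))
∑-delta {suc n} (suc a) f = begin
  0ℚ + ∑[ v < n ] [ isYes (suc a ≟ suc v) ]· f (suc v)  ≡⟨ +-identityˡ _ ⟩
  ∑[ v < n ] [ isYes (suc a ≟ suc v) ]· f (suc v)
    ≡⟨ sum-cong-≗ (λ v → cong ([_]· f (suc v)) (⌊⌋-map′ _ _ (a ≟ v))) ⟩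
  ∑[ v < n ] [ isYes (a ≟ v) ]· f (suc v)               ≡⟨ ∑-delta a (λ v → f (suc v)) ⟩
  f (suc a)                                            ∎
  where open ≡-Reasoning

∑-indicator≤ : ∀ {k} (b : Fin k → Bool) {c} → 0ℚ ≤ c →
               (∀ i j → T (b i) → T (b j) → i ≡ j) → ∑[ i < k ] [ b i ]· c ≤ c
∑-indicator≤ {zero}  b c≥0 _ = c≥0
∑-indicator≤ {suc k} b {c} c≥0 unique with T? (b zero)
... | yes b₀ = ≤-reflexive (begin
  [ b zero ]· c + ∑[ i < k ] [ b (suc i) ]· c  ≡⟨ cong₂ _+_ ([]·-true c b₀) (sum-cong-≗ others-vanish) ⟩
  c + ∑[ i < k ] 0ℚ                            ≡⟨ cong (_+_ c) (sum-replicate-zero k) ⟩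
  c + 0ℚ                                       ≡⟨ +-identityʳ c ⟩
  c                                            ∎)
  where
  open ≡-Reasoning
  others-vanish : ∀ i → [ b (suc i) ]· c ≡ 0ℚ
  others-vanish i = []·-false c (λ bᵢ → 0≢1+n (unique zero (suc i) b₀ bᵢ))
... | no ¬b₀ = begin
  [ b zero ]· c + ∑[ i < k ] [ b (suc i) ]· c  ≡⟨ cong₂ _+_ ([]·-false c ¬b₀) refl ⟩
  0ℚ + ∑[ i < k ] [ b (suc i) ]· c             ≡⟨ +-identityˡ _ ⟩
  ∑[ i < k ] [ b (suc i) ]· c                  ≤⟨ ∑-indicator≤ (λ i → b (suc i)) c≥0 unique-suc ⟩
  c                                            ∎
  where
  open ≤-Reasoning
  unique-suc : ∀ i j → T (b (suc i)) → T (b (suc j)) → i ≡ j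
  unique-suc i j bᵢ bⱼ = suc-injective (unique (suc i) (suc j) bᵢ bⱼ)

covered≤ : ∀ a b {q} → 0ℚ ≤ q → T (a ∨ b) → q ≤ [ a ]· q + [ b ]· q
covered≤ true  true  {q} q≥0 _ = begin
  q       ≡⟨ sym (+-identityʳ q) ⟩
  q + 0ℚ  ≤⟨ +-monoʳ-≤ q q≥0 ⟩
  q + q   ∎
  where open ≤-Reasoning
covered≤ true  false {q} _ _ = ≤-reflexive (sym (+-identityʳ q))
covered≤ false true  {q} _ _ = ≤-reflexive (sym (+-identityˡ q))

-- iₛ, iₜ, uₛ, uₜ say whether the endpoints of an edge lie in I and in U; the
-- boolean on the right says whether the edge lies in E_U.
I+U-incidence : ∀ {iₛ iₜ uₛ uₜ} q → ¬ (T iₛ × T iₜ) →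
                (T uₛ → T (not iₛ)) → (T uₜ → T (not iₜ)) →
                (T (not iₛ) → T (not iₜ) → T (uₛ ∨ uₜ)) →
                ([ iₛ ]· q + [ iₜ ]· q) + ([ uₛ ]· q + [ uₜ ]· q)
                  ≡ q + [ (uₛ ∧ uₜ) ∨ (uₛ ∧ iₜ) ∨ (iₛ ∧ uₜ) ]· q
I+U-incidence {true}  {true}                  q ¬both _  _  _     = ⊥-elim (¬both (tt , tt))
I+U-incidence {true}  {_}     {true}          q _     U⊆ _  _     = ⊥-elim (U⊆ tt)
I+U-incidence {_}     {true}  {_}     {true}  q _     _  U⊆ _     = ⊥-elim (U⊆ tt)
I+U-incidence {false} {false} {false} {false} q _     _  _  cover = ⊥-elim (cover tt tt)
I+U-incidence {true}  {false} {false} {true}  q _ _ _ _ = cong₂ _+_ (+-identityʳ q) (+-identityˡ q)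
I+U-incidence {true}  {false} {false} {false} q _ _ _ _ = cong₂ _+_ (+-identityʳ q) (+-identityˡ 0ℚ)
I+U-incidence {false} {true}  {true}  {false} q _ _ _ _ = cong₂ _+_ (+-identityˡ q) (+-identityʳ q)
I+U-incidence {false} {true}  {false} {false} q _ _ _ _ = cong₂ _+_ (+-identityˡ q) (+-identityˡ 0ℚ)
I+U-incidence {false} {false} {true}  {true}  q _ _ _ _ = +-identityˡ (q + q)
I+U-incidence {false} {false} {true}  {false} q _ _ _ _ = +-identityˡ (q + 0ℚ)
I+U-incidence {false} {false} {false} {true}  q _ _ _ _ = trans (+-identityˡ (0ℚ + q)) (+-comm 0ℚ q)

module _ (G : Graph) where

  incident : Fin (n G) → Fin (m G) → Bool
  incident v e = isYes (src G e ≟ v) ∨ isYes (tgt G e ≟ v)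

  inEUᵇ : VSet (n G) → VSet (n G) → Fin (m G) → Bool
  inEUᵇ I U e = (U (src G e) ∧ U (tgt G e)) ∨ (U (src G e) ∧ I (tgt G e)) ∨ (I (src G e) ∧ U (tgt G e))

  inEUᵇ⇒InEU : ∀ {I U} → (∀ v → T (U v) → T (not (I v))) → ∀ e → T (inEUᵇ I U e) → InEU G I U e
  inEUᵇ⇒InEU {I} {U} U⊆∁I e e∈E =
    Sum.map inside (Sum.map (to T-∧) (to T-∧)) (Sum.map (to T-∧) (to T-∨) (to T-∨ e∈E))
    where
    inside : T (U (src G e)) × T (U (tgt G e)) → InMinus G I e × T (U (src G e)) × T (U (tgt G e))
    inside (uₛ , uₜ) = (U⊆∁I _ uₛ , U⊆∁I _ uₜ) , uₛ , uₜ

  module _ (y : Fin (m G) → ℚ) where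

    incidence : VSet (n G) → Fin (m G) → ℚ
    incidence X e = [ X (src G e) ]· y e + [ X (tgt G e) ]· y e

    ∑-incident : ∀ X e → ∑[ v < n G ] [ X v ]· [ incident v e ]· y e ≡ incidence X e
    ∑-incident X e = begin
      ∑[ v < n G ] [ X v ]· [ incident v e ]· y e  ≡⟨ sum-cong-≗ split ⟩
      ∑[ v < n G ] (at s v + at t v)                ≡⟨ ∑-distrib-+ (at s) (at t) ⟩
      ∑[ v < n G ] at s v + ∑[ v < n G ] at t v     ≡⟨ cong₂ _+_ (∑-delta s X·y) (∑-delta t X·y) ⟩
      incidence X e                                  ∎
      where
      open ≡-Reasoning
      s t : Fin (n G)
      s = src G e
      t = tgt G e
      X·y : Fin (n G) → ℚ
      X·y v = [ X v ]· y e
      at : Fin (n G) → Fin (n G) → ℚ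
      at a v = [ isYes (a ≟ v) ]· X·y v
      not-loop : ∀ v → ¬ (T (isYes (s ≟ v)) × T (isYes (t ≟ v)))
      not-loop v (s≡v , t≡v) = loopless G e (trans (toWitness s≡v) (sym (toWitness t≡v)))
      split : ∀ v → [ X v ]· [ incident v e ]· y e ≡ at s v + at t v
      split v = trans ([]·-comm (X v) (incident v e) (y e)) ([]·-∨ (X·y v) (not-loop v))

    module _ {w : Fin (n G) → ℚ} (y-induces-w : ∀ v → sumFin (m G) (λ e → [ incident v e ]· y e) ≡ w v) where

      wt≡∑incidence : ∀ X → wt w X ≡ ∑[ e < m G ] incidence X e
      wt≡∑incidence X = begin
        wt w X                                        ≡⟨ sumFin≡∑ (n G) _ ⟩
        ∑[ v < n G ] [ X v ]· w v                      ≡⟨ sum-cong-≗ (λ v → cong ([ X v ]·_) (w-as-∑ v)) ⟩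
        ∑[ v < n G ] [ X v ]· (∑[ e < m G ] δy v e)    ≡⟨ sum-cong-≗ (λ v → []·-∑ (X v) (δy v)) ⟩
        ∑[ v < n G ] ∑[ e < m G ] [ X v ]· δy v e      ≡⟨ ∑-comm (λ v e → [ X v ]· δy v e) ⟩
        ∑[ e < m G ] ∑[ v < n G ] [ X v ]· δy v e      ≡⟨ sum-cong-≗ (∑-incident X) ⟩
        ∑[ e < m G ] incidence X e                     ∎
        where
        open ≡-Reasoning
        δy : Fin (n G) → Fin (m G) → ℚ
        δy v e = [ incident v e ]· y e
        w-as-∑ : ∀ v → w v ≡ ∑[ e < m G ] δy v e
        w-as-∑ v = trans (sym (y-induces-w v)) (sumFin≡∑ (m G) (δy v))

      wt[I]+wt[U]≡ : ∀ {I U} → Independent G I → VertexCoverMinus G I U →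
                     wt w I + wt w U ≡ ∑[ e < m G ] (y e + [ inEUᵇ I U e ]· y e)
      wt[I]+wt[U]≡ {I} {U} indep (U⊆∁I , covers) = begin
        wt w I + wt w U                                              ≡⟨ cong₂ _+_ (wt≡∑incidence I) (wt≡∑incidence U) ⟩
        ∑[ e < m G ] incidence I e + ∑[ e < m G ] incidence U e      ≡⟨ sym (∑-distrib-+ (incidence I) (incidence U)) ⟩
        ∑[ e < m G ] (incidence I e + incidence U e)                 ≡⟨ sum-cong-≗ per-edge ⟩
        ∑[ e < m G ] (y e + [ inEUᵇ I U e ]· y e)                     ∎
        where
        open ≡-Reasoning
        per-edge : ∀ e → incidence I e + incidence U e ≡ y e + [ inEUᵇ I U e ]· y e
        per-edge e = I+U-incidence (y e) (indep e) (U⊆∁I (src G e)) (U⊆∁I (tgt G e))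
                                   (λ s∉I t∉I → covers e (s∉I , t∉I))

      ∑y≤wt : (∀ e → 0ℚ ≤ y e) → ∀ {C} → VertexCover G C → ∑[ e < m G ] y e ≤ wt w C
      ∑y≤wt y≥0 {C} covers = begin
        ∑[ e < m G ] y e            ≤⟨ ∑-mono-≤ (λ e → covered≤ (C (src G e)) (C (tgt G e)) (y≥0 e) (covers e)) ⟩
        ∑[ e < m G ] incidence C e  ≡⟨ sym (wt≡∑incidence C) ⟩
        wt w C                      ∎
        where open ≤-Reasoning

      ∑[wt[I]+wt[U]]≤ : (∀ e → 0ℚ ≤ y e) → ∀ {I} → Independent G I →
                        ∀ {k} (U : Fin k → VSet (n G)) → (∀ i → VertexCoverMinus G I (U i)) →
                        (∀ i j → i ≢ j → EdgeSeparate G I (U i) (U j)) →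
                        ∑[ i < k ] (wt w I + wt w (U i)) ≤ + suc k / 1 * ∑[ e < m G ] y e
      ∑[wt[I]+wt[U]]≤ y≥0 {I} indep {k} U covers separate = begin
        ∑[ i < k ] (wt w I + wt w (U i))                       ≡⟨ sum-cong-≗ (λ i → wt[I]+wt[U]≡ indep (covers i)) ⟩
        ∑[ i < k ] ∑[ e < m G ] (y e + [ inE i e ]· y e)        ≡⟨ ∑-comm (λ i e → y e + [ inE i e ]· y e) ⟩
        ∑[ e < m G ] ∑[ i < k ] (y e + [ inE i e ]· y e)        ≡⟨ sum-cong-≗ (λ e → ∑-distrib-+ (λ _ → y e) (λ i → [ inE i e ]· y e)) ⟩
        ∑[ e < m G ] (∑[ i < k ] y e + ∑[ i < k ] [ inE i e ]· y e)
                                                               ≤⟨ ∑-mono-≤ (λ e → +-monoʳ-≤ (∑[ i < k ] y e) (at-most-one e)) ⟩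
        ∑[ e < m G ] (∑[ i < k ] y e + y e)                     ≡⟨ sum-cong-≗ (λ e → trans (+-comm _ (y e)) (∑-const (suc k) (y e))) ⟩
        ∑[ e < m G ] (+ suc k / 1 * y e)                        ≡⟨ sym (*-distribˡ-sum (+ suc k / 1) y) ⟩
        + suc k / 1 * ∑[ e < m G ] y e                          ∎
        where
        open ≤-Reasoning
        inE : Fin k → Fin (m G) → Bool
        inE i = inEUᵇ I (U i)
        unique : ∀ e i j → T (inE i e) → T (inE j e) → i ≡ j
        unique e i j e∈Eᵢ e∈Eⱼ = decidable-stable (i ≟ j) λ i≢j →
          separate i j i≢j e (inEUᵇ⇒InEU (proj₁ (covers i)) e e∈Eᵢ , inEUᵇ⇒InEU (proj₁ (covers j)) e e∈Eⱼ)
        at-most-one : ∀ e → ∑[ i < k ] [ inE i e ]· y e ≤ y e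
        at-most-one e = ∑-indicator≤ (λ i → inE i e) (y≥0 e) (unique e)

mainTheorem8 : (G : Graph) (I : VSet (n G)) →
    Independent G I → BipartiteMinus G I →
    (k : ℕ) → .{{_ : NonZero k}} →
    (U : Fin k → VSet (n G)) →
    (∀ i → VertexCoverMinus G I (U i)) →
    (∀ i j → i ≢ j → EdgeSeparate G I (U i) (U j)) →
    (w : Fin (n G) → ℚ) → InQW G w →
    (C : VSet (n G)) → IsOPT G w C →
    (C' : VSet (n G)) → IsOPTMinus G I w C' →
    ((+ k) / 1) * (wt w I + wt w C') ≤ ((+ suc k) / 1) * wt w C
mainTheorem8 G I indep _ k U covers separate w (_ , _ , y , y≥0 , y-induces-w)
             C (C-covers , _) C' (_ , C'-optimal) = begin
  + k / 1 * (wt w I + wt w C')      ≡⟨ sym (∑-const k (wt w I + wt w C')) ⟩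
  ∑[ i < k ] (wt w I + wt w C')     ≤⟨ ∑-mono-≤ (λ i → +-monoʳ-≤ (wt w I) (C'-optimal (U i) (covers i))) ⟩
  ∑[ i < k ] (wt w I + wt w (U i))  ≤⟨ ∑[wt[I]+wt[U]]≤ G y y-induces-w y≥0 indep U covers separate ⟩
  + suc k / 1 * ∑[ e < m G ] y e    ≤⟨ *-monoˡ-≤-nonNeg (+ suc k / 1) {{normalize-nonNeg (suc k) 1}}
                                         (∑y≤wt G y y-induces-w y≥0 C-covers) ⟩
  + suc k / 1 * wt w C              ∎
  where open ≤-Reasoning
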